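{- For a connected digraph $G$ of order $n\geq 2$, we have $\gamma_L(G)=n-1$ if and only if at least one of the following holds: (a) $n=3$; (b) $G$ is a directed star; (c) $V(G)$ can be partitioned into three (possibly empty) sets $S_1$, $C$ and $S_2$, such that $S_1$ and $S_2$ are independent sets, $C$ is a bidirected clique, and the remaining arcs in $G$ are all the possible arcs from $S_1$ to $C\cup S_2$ and those from $C$ to $S_2$.
   Context: Digraphs are loopless without multiple arcs. A dominating set of a digraph $G$ is a set $D$ such that every vertex not in $D$ has an in-neighbour in $D$; it is locating-dominating if moreover every vertex not in $D$ has a distinct set of in-neighbours in $D$. $\gamma_L(G)$ denotes the minimum size of a locating-dominating set of $G$. A directed star is a digraph with a special vertex belonging to all arcs and no isolated vertices. -}

module Defs where

open import Data.Nat using (ℕ; _≤_)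
open import Data.Bool using (Bool; true; false)
open import Data.Fin using (Fin)
open import Data.Fin.Subset using (Subset; _∈_; _∉_; ∣_∣)
open import Data.Product using (Σ; ∃; _×_; _,_)
open import Data.Sum using (_⊎_)
open import Relation.Nullary using (¬_)
open import Relation.Binary.PropositionalEquality using (_≡_; _≢_)
open import Function.Bundles using (_⇔_)

record Digraph (n : ℕ) : Set where
  field
    arc      : Fin n → Fin n → Bool
    loopless : ∀ v → arc v v ≡ false
open Digraph public

module _ {n : ℕ} (G : Digraph n) where

  Arc : Fin n → Fin n → Set
  Arc u v = arc G u v ≡ true

  data Reach : Fin n → Fin n → Set where
    here : ∀ {u} → Reach u u
    fwd  : ∀ {u v w} → Arc u v → Reach v w → Reach u w
    bwd  : ∀ {u v w} → Arc v u → Reach v w → Reach u w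

  -- Connected digraph = underlying graph connected (weak connectivity).
  Connected : Set
  Connected = ∀ u v → Reach u v

  Dominating : Subset n → Set
  Dominating D = ∀ v → v ∉ D → ∃ λ u → u ∈ D × Arc u v

  Locating : Subset n → Set
  Locating D = ∀ u v → u ∉ D → v ∉ D → u ≢ v →
               ¬ (∀ w → w ∈ D → (Arc w u ⇔ Arc w v))

  LocatingDominating : Subset n → Set
  LocatingDominating D = Dominating D × Locating D

  γL≡ : ℕ → Set
  γL≡ k = (∃ λ D → LocatingDominating D × ∣ D ∣ ≡ k)
        × (∀ D → LocatingDominating D → k ≤ ∣ D ∣)

  DirectedStar : Set
  DirectedStar = ∃ λ c →
      (∀ u v → Arc u v → (u ≡ c ⊎ v ≡ c))
    × (∀ v → ∃ λ w → Arc v w ⊎ Arc w v)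

data Part : Set where
  S₁ C S₂ : Part

partArc : Part → Part → Bool
partArc S₁ S₁ = false
partArc S₁ C  = true
partArc S₁ S₂ = true
partArc C  S₁ = false
partArc C  C  = true
partArc C  S₂ = true
partArc S₂ _  = false

module _ {n : ℕ} (G : Digraph n) where
  ThreePartStructure : Set
  ThreePartStructure = Σ (Fin n → Part) λ f →
    ∀ u v → u ≢ v → arc G u v ≡ partArc (f u) (f v)

-- A locating-dominating set of size at most n − 2 exists iff V ∖ {a, b} is one for some
-- a ≢ b, i.e. iff a and b are separable: both have an in-neighbour outside {a, b} and a
-- third vertex sees exactly one of them.  As V ∖ {v} is locating-dominating whenever v
-- has an in-neighbour, γ_L(G) = n − 1 iff no pair is separable, and none of the three
-- structures has a separable pair.  Conversely, without separable pairs, if z → x but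
-- z ↛ y for an entered y ≢ z, then x is the only in-neighbour of every vertex other than
-- x and z.  Label sources S₁, other vertices with an out-arc C and the rest S₂: a pair
-- violating condition (c) is such a missing arc, and then G is a directed star centred
-- at x unless y → z.  In that case every vertex outside {x, y, z} must be a source, which
-- again yields a star, so otherwise n = 3.

module Submission where

open import Defs
open import Data.Nat using (ℕ; _≤_; _≰_; _∸_; _+_; s≤s; z≤n)
open import Data.Nat.Properties
  using (≤-trans; ≤-reflexive; ≤-antisym; +-suc; +-monoʳ-≤; +-mono-≤; n≤1+n; m∸n≤m; m≤n+o⇒m∸n≤o;
         ∸-monoˡ-≤; <⇒≱; module ≤-Reasoning)
open import Data.Bool using (true; false)
import Data.Bool.Properties as Bool
open import Data.Vec using (_∷_; [])
open import Data.Fin using (Fin; zero; suc; _≟_)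
open import Data.Fin.Subset using (Subset; _∈_; _∉_; ∣_∣; ⊤; ∁; ⁅_⁆; _∪_; _-_; inside; outside)
open import Data.Fin.Subset.Properties
  using (_∈?_; ∈⊤; ∣⊤∣≡n; ∣⁅x⁆∣≡1; ∣∁p∣≡n∸∣p∣; p⊆q⇒∣p∣≤∣q∣; x∈p⇒∣p-x∣<∣p∣; x∈p∧x≢y⇒x∈p-y;
         x∈⁅x⁆; x∈⁅y⁆⇒x≡y; x≢y⇒x∉⁅y⁆; x∉∁p⇒x∈p; x∉p⇒x∈∁p; x∈p∪q⁺)
open import Data.Fin.Properties using (any?)
open import Data.Product using (∃; _×_; _,_; proj₁; proj₂)
open import Data.Sum using (_⊎_; inj₁; inj₂; [_,_]′; map₂)
open import Data.Empty using (⊥-elim)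
open import Function using (id; _∘_)
open import Function.Bundles using (_⇔_; mk⇔; Equivalence)
open import Function.Properties.Equivalence using () renaming (sym to ⇔-sym; trans to ⇔-trans)
open import Relation.Nullary using (¬_; Dec; yes; no; ¬?)
open import Relation.Nullary.Decidable using (decidable-stable; toSum; _×-dec_; _⊎-dec_)
open import Relation.Binary.PropositionalEquality
  using (_≡_; _≢_; refl; sym; trans; cong; cong₂; subst; ≢-sym; module ≡-Reasoning)

∣p∪q∣≤∣p∣+∣q∣ : ∀ {n} (p q : Subset n) → ∣ p ∪ q ∣ ≤ ∣ p ∣ + ∣ q ∣
∣p∪q∣≤∣p∣+∣q∣ []            []            = z≤n
∣p∪q∣≤∣p∣+∣q∣ (outside ∷ p) (outside ∷ q) = ∣p∪q∣≤∣p∣+∣q∣ p q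
∣p∪q∣≤∣p∣+∣q∣ (outside ∷ p) (inside  ∷ q) =
  ≤-trans (s≤s (∣p∪q∣≤∣p∣+∣q∣ p q)) (≤-reflexive (sym (+-suc ∣ p ∣ ∣ q ∣)))
∣p∪q∣≤∣p∣+∣q∣ (inside  ∷ p) (outside ∷ q) = s≤s (∣p∪q∣≤∣p∣+∣q∣ p q)
∣p∪q∣≤∣p∣+∣q∣ (inside  ∷ p) (inside  ∷ q) =
  s≤s (≤-trans (∣p∪q∣≤∣p∣+∣q∣ p q) (+-monoʳ-≤ ∣ p ∣ (n≤1+n ∣ q ∣)))

∀x∈p⇒n≤∣p∣ : ∀ {n} {p : Subset n} → (∀ x → x ∈ p) → n ≤ ∣ p ∣
∀x∈p⇒n≤∣p∣ {n} all = ≤-trans (≤-reflexive (sym (∣⊤∣≡n n))) (p⊆q⇒∣p∣≤∣q∣ {p = ⊤} λ {x} _ → all x)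

x,y∈p⇒2+∣p-x-y∣≤∣p∣ : ∀ {n} {p : Subset n} {x y} → x ∈ p → y ∈ p → x ≢ y →
                      2 + ∣ p - x - y ∣ ≤ ∣ p ∣
x,y∈p⇒2+∣p-x-y∣≤∣p∣ x∈p y∈p x≢y =
  ≤-trans (s≤s (x∈p⇒∣p-x∣<∣p∣ (x∈p∧x≢y⇒x∈p-y y∈p (≢-sym x≢y)))) (x∈p⇒∣p-x∣<∣p∣ x∈p)

2+∣⊤-x-y∣≤n : ∀ {n} {x y : Fin n} → x ≢ y → 2 + ∣ ⊤ - x - y ∣ ≤ n
2+∣⊤-x-y∣≤n {n} x≢y = ≤-trans (x,y∈p⇒2+∣p-x-y∣≤∣p∣ ∈⊤ ∈⊤ x≢y) (≤-reflexive (∣⊤∣≡n n))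

∈⊤-x-y : ∀ {n} {w x y : Fin n} → w ≢ x → w ≢ y → w ∈ ⊤ - x - y
∈⊤-x-y w≢x w≢y = x∈p∧x≢y⇒x∈p-y (x∈p∧x≢y⇒x∈p-y ∈⊤ w≢x) w≢y

∉⊤-x-y⇒≡ : ∀ {n} {w x y : Fin n} → w ∉ ⊤ - x - y → w ≡ x ⊎ w ≡ y
∉⊤-x-y⇒≡ {w = w} {x} {y} w∉ with w ≟ x | w ≟ y
... | yes w≡x | _        = inj₁ w≡x
... | no _    | yes w≡y  = inj₂ w≡y
... | no w≢x  | no w≢y   = ⊥-elim (w∉ (∈⊤-x-y w≢x w≢y))

∣∁⁅x⁆∣≡n∸1 : ∀ {n} (x : Fin n) → ∣ ∁ ⁅ x ⁆ ∣ ≡ n ∸ 1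
∣∁⁅x⁆∣≡n∸1 {n} x = trans (∣∁p∣≡n∸∣p∣ ⁅ x ⁆) (cong (n ∸_) (∣⁅x⁆∣≡1 x))

∉-unique⇒n∸1≤∣p∣ : ∀ {n} {p : Subset n} → (∀ {a b} → a ∉ p → b ∉ p → a ≡ b) → n ∸ 1 ≤ ∣ p ∣
∉-unique⇒n∸1≤∣p∣ {n} {p} unique with any? (λ a → ¬? (a ∈? p))
... | no all-in =
  ≤-trans (m∸n≤m n 1) (∀x∈p⇒n≤∣p∣ λ a → decidable-stable (a ∈? p) λ a∉p → all-in (a , a∉p))
... | yes (a , a∉p) = m≤n+o⇒m∸n≤o n 1 (begin
  n                  ≤⟨ ∀x∈p⇒n≤∣p∣ covered ⟩
  ∣ ⁅ a ⁆ ∪ p ∣      ≤⟨ ∣p∪q∣≤∣p∣+∣q∣ ⁅ a ⁆ p ⟩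
  ∣ ⁅ a ⁆ ∣ + ∣ p ∣  ≡⟨ cong (_+ ∣ p ∣) (∣⁅x⁆∣≡1 a) ⟩
  1 + ∣ p ∣          ∎)
  where
  open ≤-Reasoning
  covered : ∀ b → b ∈ ⁅ a ⁆ ∪ p
  covered b with b ∈? p
  ... | yes b∈p = x∈p∪q⁺ (inj₂ b∈p)
  ... | no b∉p  = x∈p∪q⁺ (inj₁ (subst (_∈ ⁅ a ⁆) (sym (unique b∉p a∉p)) (x∈⁅x⁆ a)))

distinct-cover⇒n≡3 : ∀ {n} {x y z : Fin n} → x ≢ y → x ≢ z → y ≢ z →
                     (∀ w → w ≢ x → w ≢ y → w ≡ z) → n ≡ 3
distinct-cover⇒n≡3 {n} {x} {y} {z} x≢y x≢z y≢z cover = ≤-antisym upper lower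
  where
  open ≤-Reasoning
  covered : ∀ w → w ∈ ⁅ x ⁆ ∪ (⁅ y ⁆ ∪ ⁅ z ⁆)
  covered w with w ≟ x | w ≟ y
  ... | yes refl | _        = x∈p∪q⁺ (inj₁ (x∈⁅x⁆ x))
  ... | no _     | yes refl = x∈p∪q⁺ (inj₂ (x∈p∪q⁺ (inj₁ (x∈⁅x⁆ y))))
  ... | no w≢x   | no w≢y   =
    x∈p∪q⁺ (inj₂ (x∈p∪q⁺ (inj₂ (subst (_∈ ⁅ z ⁆) (sym (cover w w≢x w≢y)) (x∈⁅x⁆ z)))))
  upper : n ≤ 3
  upper = begin
    n                                ≤⟨ ∀x∈p⇒n≤∣p∣ covered ⟩
    ∣ ⁅ x ⁆ ∪ (⁅ y ⁆ ∪ ⁅ z ⁆) ∣      ≤⟨ ∣p∪q∣≤∣p∣+∣q∣ ⁅ x ⁆ _ ⟩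
    ∣ ⁅ x ⁆ ∣ + ∣ ⁅ y ⁆ ∪ ⁅ z ⁆ ∣    ≤⟨ +-mono-≤ (≤-reflexive (∣⁅x⁆∣≡1 x)) (∣p∪q∣≤∣p∣+∣q∣ ⁅ y ⁆ ⁅ z ⁆) ⟩
    1 + (∣ ⁅ y ⁆ ∣ + ∣ ⁅ z ⁆ ∣)      ≡⟨ cong₂ (λ k l → 1 + (k + l)) (∣⁅x⁆∣≡1 y) (∣⁅x⁆∣≡1 z) ⟩
    3                                ∎
  lower : 3 ≤ n
  lower = begin
    3                  ≤⟨ +-monoʳ-≤ 2 (≤-trans (s≤s z≤n) (x∈p⇒∣p-x∣<∣p∣ (∈⊤-x-y (≢-sym x≢z) (≢-sym y≢z)))) ⟩
    2 + ∣ ⊤ - x - y ∣  ≤⟨ 2+∣⊤-x-y∣≤n x≢y ⟩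
    n                  ∎

third-vertex : ∀ {a b s t : Fin 3} → a ≢ b → s ≢ a → s ≢ b → t ≢ a → t ≢ b → s ≡ t
third-vertex {a} {b} {s} {t} a≢b s≢a s≢b t≢a t≢b = decidable-stable (s ≟ t) λ s≢t →
  4+k≰3 (≤-trans (+-monoʳ-≤ 2 (x,y∈p⇒2+∣p-x-y∣≤∣p∣ (∈⊤-x-y s≢a s≢b) (∈⊤-x-y t≢a t≢b) s≢t))
                 (2+∣⊤-x-y∣≤n a≢b))
  where
  4+k≰3 : ∀ {k} → 4 + k ≰ 3
  4+k≰3 (s≤s (s≤s (s≤s ())))

partArc-S₁ : ∀ p → partArc p S₁ ≡ false
partArc-S₁ S₁ = refl
partArc-S₁ C  = refl
partArc-S₁ S₂ = refl

partArc-≢S₁ : ∀ p {q} → q ≢ S₁ → partArc p q ≡ partArc p C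
partArc-≢S₁ p  {S₁} q≢S₁ = ⊥-elim (q≢S₁ refl)
partArc-≢S₁ p  {C}  _    = refl
partArc-≢S₁ S₁ {S₂} _    = refl
partArc-≢S₁ C  {S₂} _    = refl
partArc-≢S₁ S₂ {S₂} _    = refl

module _ {n : ℕ} (G : Digraph n) where

  arc? : ∀ u v → Dec (Arc G u v)
  arc? u v = arc G u v Bool.≟ true

  ¬Arc⇒false : ∀ {u v} → ¬ Arc G u v → arc G u v ≡ false
  ¬Arc⇒false = Bool.¬-not

  Arc⇒≢ : ∀ {u v} → Arc G u v → u ≢ v
  Arc⇒≢ {u} uv refl = Bool.not-¬ (loopless G u) uv

  step-from : ∀ {u w} → Reach G u w → u ≢ w → ∃ λ v → Arc G u v ⊎ Arc G v u
  step-from here       u≢w = ⊥-elim (u≢w refl)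
  step-from (fwd uv _) _   = _ , inj₁ uv
  step-from (bwd vu _) _   = _ , inj₂ vu

  has-neighbour : 2 ≤ n → Connected G → ∀ v → ∃ λ w → Arc G v w ⊎ Arc G w v
  has-neighbour (s≤s (s≤s _)) conn zero    = step-from (conn zero (suc zero)) λ ()
  has-neighbour (s≤s (s≤s _)) conn (suc v) = step-from (conn (suc v) zero) λ ()

  has-arc : 2 ≤ n → Connected G → ∃ λ u → ∃ λ v → Arc G u v
  has-arc n≥2@(s≤s _) conn with has-neighbour n≥2 conn zero
  ... | w , inj₁ zw = zero , w , zw
  ... | w , inj₂ wz = w , zero , wz

  Distinguishes : Fin n → Fin n → Fin n → Set
  Distinguishes t a b = (Arc G t a × ¬ Arc G t b) ⊎ (¬ Arc G t a × Arc G t b)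

  distinguishes? : ∀ t a b → Dec (Distinguishes t a b)
  distinguishes? t a b = (arc? t a ×-dec ¬? (arc? t b)) ⊎-dec (¬? (arc? t a) ×-dec arc? t b)

  Distinguishes⇒¬⇔ : ∀ {t a b} → Distinguishes t a b → ¬ (Arc G t a ⇔ Arc G t b)
  Distinguishes⇒¬⇔ (inj₁ (ta , ¬tb)) ta⇔tb = ¬tb (Equivalence.to ta⇔tb ta)
  Distinguishes⇒¬⇔ (inj₂ (¬ta , tb)) ta⇔tb = ¬ta (Equivalence.from ta⇔tb tb)

  ¬Distinguishes⇒⇔ : ∀ {t a b} → ¬ Distinguishes t a b → Arc G t a ⇔ Arc G t b
  ¬Distinguishes⇒⇔ {t} {a} {b} ¬d = mk⇔
    (λ ta → decidable-stable (arc? t b) λ ¬tb → ¬d (inj₁ (ta , ¬tb)))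
    (λ tb → decidable-stable (arc? t a) λ ¬ta → ¬d (inj₂ (¬ta , tb)))

  Separable : Fin n → Fin n → Set
  Separable a b = (∃ λ t → t ≢ b × Arc G t a) × (∃ λ t → t ≢ a × Arc G t b)
                × (∃ λ t → t ≢ a × t ≢ b × Distinguishes t a b)

  NoSeparablePair : Set
  NoSeparablePair = ∀ a b → a ≢ b → ¬ Separable a b

  ld⇒separable : ∀ {D a b} → LocatingDominating G D → a ∉ D → b ∉ D → a ≢ b → Separable a b
  ld⇒separable {D} {a} {b} (dominating , locating) a∉D b∉D a≢b =
    in-neighbour a∉D b∉D , in-neighbour b∉D a∉D , distinguisher
    where
    ∈⇒≢ : ∀ {t x} → t ∈ D → x ∉ D → t ≢ x
    ∈⇒≢ t∈D x∉D refl = x∉D t∈D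
    in-neighbour : ∀ {x y} → x ∉ D → y ∉ D → ∃ λ t → t ≢ y × Arc G t x
    in-neighbour x∉D y∉D with dominating _ x∉D
    ... | t , t∈D , tx = t , ∈⇒≢ t∈D y∉D , tx
    distinguisher : ∃ λ t → t ≢ a × t ≢ b × Distinguishes t a b
    distinguisher with any? (λ t → t ∈? D ×-dec distinguishes? t a b)
    ... | yes (t , t∈D , d) = t , ∈⇒≢ t∈D a∉D , ∈⇒≢ t∈D b∉D , d
    ... | no none = ⊥-elim (locating a b a∉D b∉D a≢b λ t t∈D →
                              ¬Distinguishes⇒⇔ λ d → none (t , t∈D , d))

  separable⇒ld : ∀ {a b} → a ≢ b → Separable a b → LocatingDominating G (⊤ - a - b)
  separable⇒ld {a} {b} a≢b ((t₁ , t₁≢b , t₁a) , (t₂ , t₂≢a , t₂b) , (t , t≢a , t≢b , d)) =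
    dominating , locating
    where
    dominating : Dominating G (⊤ - a - b)
    dominating v v∉ with ∉⊤-x-y⇒≡ v∉
    ... | inj₁ refl = t₁ , ∈⊤-x-y (Arc⇒≢ t₁a) t₁≢b , t₁a
    ... | inj₂ refl = t₂ , ∈⊤-x-y t₂≢a (Arc⇒≢ t₂b) , t₂b
    t∈ : t ∈ ⊤ - a - b
    t∈ = ∈⊤-x-y t≢a t≢b
    locating : Locating G (⊤ - a - b)
    locating u v u∉ v∉ u≢v same with ∉⊤-x-y⇒≡ u∉ | ∉⊤-x-y⇒≡ v∉
    ... | inj₁ refl | inj₁ refl = u≢v refl
    ... | inj₂ refl | inj₂ refl = u≢v refl
    ... | inj₁ refl | inj₂ refl = Distinguishes⇒¬⇔ d (same t t∈)
    ... | inj₂ refl | inj₁ refl = Distinguishes⇒¬⇔ d (⇔-sym (same t t∈))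

  γ-bound⇒no-separable-pair : (∀ D → LocatingDominating G D → n ∸ 1 ≤ ∣ D ∣) → NoSeparablePair
  γ-bound⇒no-separable-pair bound a b a≢b sep =
    <⇒≱ (∸-monoˡ-≤ 1 (2+∣⊤-x-y∣≤n a≢b)) (bound _ (separable⇒ld a≢b sep))

  no-separable-pair⇒γ-bound : NoSeparablePair → ∀ D → LocatingDominating G D → n ∸ 1 ≤ ∣ D ∣
  no-separable-pair⇒γ-bound nsp D ld = ∉-unique⇒n∸1≤∣p∣ λ {a} {b} a∉D b∉D →
    decidable-stable (a ≟ b) λ a≢b → nsp a b a≢b (ld⇒separable ld a∉D b∉D a≢b)

  arc⇒ld-∁⁅head⁆ : ∀ {u v} → Arc G u v → LocatingDominating G (∁ ⁅ v ⁆)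
  arc⇒ld-∁⁅head⁆ {u} {v} uv = dominating , locating
    where
    ∉∁⁅v⁆⇒≡v : ∀ {w} → w ∉ ∁ ⁅ v ⁆ → w ≡ v
    ∉∁⁅v⁆⇒≡v w∉ = x∈⁅y⁆⇒x≡y v (x∉∁p⇒x∈p w∉)
    dominating : Dominating G (∁ ⁅ v ⁆)
    dominating w w∉ with ∉∁⁅v⁆⇒≡v w∉
    ... | refl = u , x∉p⇒x∈∁p (x≢y⇒x∉⁅y⁆ (Arc⇒≢ uv)) , uv
    locating : Locating G (∁ ⁅ v ⁆)
    locating w w′ w∉ w′∉ w≢w′ _ = w≢w′ (trans (∉∁⁅v⁆⇒≡v w∉) (sym (∉∁⁅v⁆⇒≡v w′∉)))

  γL≡n∸1⇔no-separable-pair : (∃ λ u → ∃ λ v → Arc G u v) → γL≡ G (n ∸ 1) ⇔ NoSeparablePair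
  γL≡n∸1⇔no-separable-pair (_ , v , uv) = mk⇔
    (λ (_ , bound) → γ-bound⇒no-separable-pair bound)
    (λ nsp → (∁ ⁅ v ⁆ , arc⇒ld-∁⁅head⁆ uv , ∣∁⁅x⁆∣≡n∸1 v) , no-separable-pair⇒γ-bound nsp)

  n≡3⇒no-separable-pair : n ≡ 3 → NoSeparablePair
  n≡3⇒no-separable-pair refl a b a≢b ((t₁ , t₁≢b , t₁a) , (t₂ , t₂≢a , t₂b) , (t , t≢a , t≢b , d)) =
    Distinguishes⇒¬⇔ d (mk⇔
      (λ _ → subst (λ s → Arc G s b) (third-vertex a≢b t₂≢a (Arc⇒≢ t₂b) t≢a t≢b) t₂b)
      (λ _ → subst (λ s → Arc G s a) (third-vertex a≢b (Arc⇒≢ t₁a) t₁≢b t≢a t≢b) t₁a))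

  directed-star⇒no-separable-pair : DirectedStar G → NoSeparablePair
  directed-star⇒no-separable-pair (c , touches , _) a b a≢b
    ((t₁ , t₁≢b , t₁a) , (t₂ , t₂≢a , t₂b) , (t , _ , _ , d)) with a ≟ c | b ≟ c
  ... | yes refl | _        = [ t₂≢a , ≢-sym a≢b ]′ (touches t₂ b t₂b)
  ... | no _     | yes refl = [ t₁≢b , a≢b ]′ (touches t₁ a t₁a)
  ... | no a≢c   | no b≢c   = Distinguishes⇒¬⇔ d (mk⇔ (reroute a≢c b≢c t₂b) (reroute b≢c a≢c t₁a))
    where
    in-neighbour≡c : ∀ {s x} → x ≢ c → Arc G s x → s ≡ c
    in-neighbour≡c x≢c sx = [ id , ⊥-elim ∘ x≢c ]′ (touches _ _ sx)
    reroute : ∀ {x y s} → x ≢ c → y ≢ c → Arc G s y → Arc G t x → Arc G t y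
    reroute x≢c y≢c sy tx =
      subst (λ r → Arc G r _) (trans (in-neighbour≡c y≢c sy) (sym (in-neighbour≡c x≢c tx))) sy

  three-part⇒no-separable-pair : ThreePartStructure G → NoSeparablePair
  three-part⇒no-separable-pair (f , arc≡) a b _ ((_ , _ , t₁a) , (_ , _ , t₂b) , (t , t≢a , t≢b , d)) =
    Distinguishes⇒¬⇔ d (mk⇔ (trans (sym same)) (trans same))
    where
    entered⇒≢S₁ : ∀ {s x} → Arc G s x → f x ≢ S₁
    entered⇒≢S₁ {s} {x} sx fx≡S₁ = Bool.not-¬
      (trans (arc≡ s x (Arc⇒≢ sx)) (trans (cong (partArc (f s)) fx≡S₁) (partArc-S₁ (f s)))) sx
    same : arc G t a ≡ arc G t b
    same = begin
      arc G t a              ≡⟨ arc≡ t a t≢a ⟩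
      partArc (f t) (f a)    ≡⟨ partArc-≢S₁ (f t) (entered⇒≢S₁ t₁a) ⟩
      partArc (f t) C        ≡⟨ sym (partArc-≢S₁ (f t) (entered⇒≢S₁ t₂b)) ⟩
      partArc (f t) (f b)    ≡⟨ sym (arc≡ t b t≢b) ⟩
      arc G t b              ∎
      where open ≡-Reasoning

  data Kind (v : Fin n) : Part → Set where
    source : (∀ u → ¬ Arc G u v) → Kind v S₁
    inner  : (∃ λ u → Arc G u v) → (∃ λ w → Arc G v w) → Kind v C
    sink   : (∃ λ u → Arc G u v) → (∀ w → ¬ Arc G v w) → Kind v S₂

  kind : ∀ v → ∃ (Kind v)
  kind v with any? (λ u → arc? u v) | any? (arc? v)
  ... | no ¬entered | _        = S₁ , source λ u uv → ¬entered (u , uv)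
  ... | yes entered | yes left = C , inner entered left
  ... | yes entered | no ¬left = S₂ , sink entered λ w vw → ¬left (w , vw)

  label : Fin n → Part
  label v = proj₁ (kind v)

  module _ (n≥2 : 2 ≤ n) (conn : Connected G) (nsp : NoSeparablePair) where

    arc-transfer : ∀ {a b t₁ t₂ t} → a ≢ b → Arc G t₁ a → t₁ ≢ b → Arc G t₂ b → t₂ ≢ a →
                   t ≢ b → Arc G t a → Arc G t b
    arc-transfer {a} {b} {t₁} {t₂} {t} a≢b t₁a t₁≢b t₂b t₂≢a t≢b ta =
      decidable-stable (arc? t b) λ ¬tb →
        nsp a b a≢b ((t₁ , t₁≢b , t₁a) , (t₂ , t₂≢a , t₂b) , (t , Arc⇒≢ ta , t≢b , inj₁ (ta , ¬tb)))

    sole-in-neighbour : ∀ {x y z t} → z ≢ y → Arc G z x → ¬ Arc G z y → Arc G t y → t ≡ x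
    sole-in-neighbour z≢y zx ¬zy ty = decidable-stable (_ ≟ _) λ t≢x →
      ¬zy (arc-transfer (λ { refl → ¬zy zx }) zx z≢y ty t≢x z≢y zx)

    out-neighbour≡x : ∀ {x y z t w} → z ≢ y → Arc G z x → ¬ Arc G z y → Arc G t y → Arc G z w → w ≡ x
    out-neighbour≡x z≢y zx ¬zy ty zw =
      trans (sym (sole-in-neighbour z≢y zw ¬zy ty)) (sole-in-neighbour z≢y zx ¬zy ty)

    in-neighbour≡x : ∀ {x y z t a w} → z ≢ y → Arc G z x → ¬ Arc G z y → Arc G t y →
                     w ≢ x → w ≢ z → Arc G a w → a ≡ x
    in-neighbour≡x {z = z} {w = w} z≢y zx ¬zy ty w≢x w≢z aw with arc? z w
    ... | yes zw  = ⊥-elim (w≢x (out-neighbour≡x z≢y zx ¬zy ty zw))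
    ... | no ¬zw = sole-in-neighbour (≢-sym w≢z) zx ¬zw aw

    centre⇒directed-star : ∀ c → (∀ {a b} → b ≢ c → Arc G a b → a ≡ c) → DirectedStar G
    centre⇒directed-star c into-c = c , touches , has-neighbour n≥2 conn
      where
      touches : ∀ a b → Arc G a b → a ≡ c ⊎ b ≡ c
      touches a b ab with b ≟ c
      ... | yes b≡c = inj₂ b≡c
      ... | no b≢c  = inj₁ (into-c b≢c ab)

    source⇒directed-star : ∀ {s y t} → (∀ a → ¬ Arc G a s) → ¬ Arc G s y → Arc G t y → DirectedStar G
    source⇒directed-star {s} {y} {t} ¬entered ¬sy ty with has-neighbour n≥2 conn s
    ... | v , inj₂ vs = ⊥-elim (¬entered v vs)
    ... | v , inj₁ sv = centre⇒directed-star v λ b≢v ab →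
      in-neighbour≡x (λ { refl → ¬entered t ty }) sv ¬sy ty b≢v (λ { refl → ¬entered _ ab }) ab

    module _ {x y z t} (z≢y : z ≢ y) (zx : Arc G z x) (¬zy : ¬ Arc G z y) (ty : Arc G t y) where

      private
        xy : Arc G x y
        xy = subst (λ s → Arc G s y) (sole-in-neighbour z≢y zx ¬zy ty) ty
        x≢y : x ≢ y
        x≢y = Arc⇒≢ xy
        x≢z : x ≢ z
        x≢z = ≢-sym (Arc⇒≢ zx)

      ¬yz⇒directed-star : ¬ Arc G y z → DirectedStar G
      ¬yz⇒directed-star ¬yz = centre⇒directed-star x into-x
        where
        into-x : ∀ {a b} → b ≢ x → Arc G a b → a ≡ x
        into-x {a} {b} b≢x ab with b ≟ z
        ... | yes refl = sole-in-neighbour z≢y zx ¬zy (arc-transfer z≢y ab a≢y xy x≢z a≢y ab)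
          where
          a≢y : a ≢ y
          a≢y refl = ¬yz ab
        ... | no b≢z = in-neighbour≡x z≢y zx ¬zy ty b≢x b≢z ab

      fourth-vertex⇒directed-star : Arc G y z → ∀ {w} → w ≢ x → w ≢ y → w ≢ z → DirectedStar G
      fourth-vertex⇒directed-star yz {w} w≢x w≢y w≢z with any? (λ a → arc? a w)
      ... | no ¬entered = source⇒directed-star (λ a aw → ¬entered (a , aw)) ¬wy ty
        where
        ¬wy : ¬ Arc G w y
        ¬wy wy = w≢x (sole-in-neighbour z≢y zx ¬zy wy)
      ... | yes (a , aw) = ⊥-elim (w≢x (out-neighbour≡x z≢y zx ¬zy ty zw))
        where
        xw : Arc G x w
        xw = subst (λ s → Arc G s w) (in-neighbour≡x z≢y zx ¬zy ty w≢x w≢z aw) aw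
        yw : Arc G y w
        yw = arc-transfer (≢-sym w≢z) yz (≢-sym w≢y) xw x≢z (≢-sym w≢y) yz
        zw : Arc G z w
        zw = arc-transfer (≢-sym w≢x) zx (≢-sym w≢z) yw (≢-sym x≢y) (≢-sym w≢z) zx

      missing-arc⇒n≡3⊎directed-star : n ≡ 3 ⊎ DirectedStar G
      missing-arc⇒n≡3⊎directed-star with arc? y z
      ... | no ¬yz = inj₂ (¬yz⇒directed-star ¬yz)
      ... | yes yz with any? (λ w → ¬? (w ≟ x) ×-dec ¬? (w ≟ y) ×-dec ¬? (w ≟ z))
      ...   | yes (w , w≢x , w≢y , w≢z) = inj₂ (fourth-vertex⇒directed-star yz w≢x w≢y w≢z)
      ...   | no none = inj₁ (distinct-cover⇒n≡3 x≢y x≢z (≢-sym z≢y) λ w w≢x w≢y →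
                          decidable-stable (w ≟ z) λ w≢z → none (w , w≢x , w≢y , w≢z))

    arc-from-source : ∀ {u v t} → (∀ a → ¬ Arc G a u) → Arc G t v →
                      Arc G u v ⊎ (n ≡ 3 ⊎ DirectedStar G)
    arc-from-source ¬entered tv = map₂ (λ ¬uv → inj₂ (source⇒directed-star ¬entered ¬uv tv)) (toSum (arc? _ _))

    arc-from-inner : ∀ {u v w t} → u ≢ v → Arc G u w → Arc G t v →
                     Arc G u v ⊎ (n ≡ 3 ⊎ DirectedStar G)
    arc-from-inner u≢v uw tv = map₂ (λ ¬uv → missing-arc⇒n≡3⊎directed-star u≢v uw ¬uv tv) (toSum (arc? _ _))

    arc-matches-kinds : ∀ {u v p q} → Kind u p → Kind v q → u ≢ v →
                        arc G u v ≡ partArc p q ⊎ (n ≡ 3 ⊎ DirectedStar G)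
    arc-matches-kinds {p = p} _ (source ¬entered) _ =
      inj₁ (trans (¬Arc⇒false (¬entered _)) (sym (partArc-S₁ p)))
    arc-matches-kinds (sink _ ¬left) _ _ = inj₁ (¬Arc⇒false (¬left _))
    arc-matches-kinds (source ¬entered) (inner (_ , tv) _) _   = arc-from-source ¬entered tv
    arc-matches-kinds (source ¬entered) (sink  (_ , tv) _) _   = arc-from-source ¬entered tv
    arc-matches-kinds (inner _ (_ , uw)) (inner (_ , tv) _) u≢v = arc-from-inner u≢v uw tv
    arc-matches-kinds (inner _ (_ , uw)) (sink  (_ , tv) _) u≢v = arc-from-inner u≢v uw tv

    no-separable-pair⇒cases : n ≡ 3 ⊎ DirectedStar G ⊎ ThreePartStructure G
    no-separable-pair⇒cases
      with any? (λ u → any? λ v → ¬? (u ≟ v) ×-dec ¬? (arc G u v Bool.≟ partArc (label u) (label v)))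
    ... | no none = inj₂ (inj₂ (label , λ u v u≢v →
            decidable-stable (_ Bool.≟ _) λ mismatch → none (u , v , u≢v , mismatch)))
    ... | yes (u , v , u≢v , mismatch) with arc-matches-kinds (proj₂ (kind u)) (proj₂ (kind v)) u≢v
    ...   | inj₁ match       = ⊥-elim (mismatch match)
    ...   | inj₂ exceptional = map₂ inj₁ exceptional

theorem6 : ∀ (n : ℕ) (G : Digraph n) → 2 ≤ n → Connected G →
    (γL≡ G (n ∸ 1) ⇔ (n ≡ 3 ⊎ DirectedStar G ⊎ ThreePartStructure G))
theorem6 n G n≥2 conn = ⇔-trans (γL≡n∸1⇔no-separable-pair G (has-arc G n≥2 conn)) (mk⇔
  (no-separable-pair⇒cases G n≥2 conn)
  [ n≡3⇒no-separable-pair G , [ directed-star⇒no-separable-pair G , three-part⇒no-separable-pair G ]′ ]′)
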